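{- Let $k\ge1$ and consider rowmotion $\rho$ acting on $\mathcal{J}({\sf V}_k)$. For $s\in{\sf V}_k$ let $\chi_s:\mathcal{J}({\sf V}_k)\to\{0,1\}$ be the indicator function $\chi_s(I)=1$ iff $s\in I$. Then: (1) for every $i\in[k]$, the statistic $\chi_{\ell_i}-\chi_{r_i}$ is $0$-mesic; (2) the statistic $\chi_{\ell_1}+\chi_{r_1}-\chi_{c_k}$ is $\frac{2(k-1)}{k+2}$-mesic.
   Context: ${\sf V}$ is the 3-element poset with elements $c,\ell,r$ and relations $c<\ell$, $c<r$. ${\sf V}_k={\sf V}\times[k]$ with the product order, where $[k]=\{1<\dots<k\}$; write $\ell_i=(\ell,i)$, $c_i=(c,i)$, $r_i=(r,i)$. $\mathcal{J}(P)$ is the set of order ideals of $P$; rowmotion $\rho$ sends an order ideal $I$ to the order ideal generated by the minimal elements of $P\setminus I$. A statistic $g$ on a finite set $S$ is called $c$-mesic with respect to an invertible map $\varphi:S\to S$ if for every $\varphi$-orbit $\mathcal{O}$, $\frac{1}{\#\mathcal{O}}\sum_{x\in\mathcal{O}}g(x)=c$. -}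

module Defs where

open import Data.Bool using (Bool; true; false; _∧_; _∨_; not; if_then_else_; T)
open import Data.Nat using (ℕ; zero; suc; _<_) renaming (_≤ᵇ_ to _≤ℕᵇ_)
open import Data.Fin using (Fin; zero; suc; toℕ)
open import Data.Vec using (Vec; lookup; tabulate)
open import Data.Product using (_×_; _,_)
open import Data.Integer using (+_)
open import Data.Rational using (ℚ; 0ℚ; 1ℚ; _+_; _*_; _/_)
open import Relation.Binary.PropositionalEquality using (_≡_; _≢_)

data V : Set where
  c ℓ r : V

_≤V_ : V → V → Bool
c ≤V _ = true
ℓ ≤V ℓ = true
r ≤V r = true
_ ≤V _ = false

_==V_ : V → V → Bool
c ==V c = true
ℓ ==V ℓ = true
r ==V r = true
_ ==V _ = false

-- V_k = V × [k] with the product order; [k] is represented by Fin k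
-- (index 0 ↔ 1, …, index k-1 ↔ k).

Elem : ℕ → Set
Elem k = V × Fin k

_≤P_ : ∀ {k} → Elem k → Elem k → Bool
(x , i) ≤P (y , j) = (x ≤V y) ∧ (toℕ i ≤ℕᵇ toℕ j)

_==P_ : ∀ {k} → Elem k → Elem k → Bool
(x , i) ==P (y , j) = (x ==V y) ∧ ((toℕ i ≤ℕᵇ toℕ j) ∧ (toℕ j ≤ℕᵇ toℕ i))

_<P_ : ∀ {k} → Elem k → Elem k → Bool
p <P q = (p ≤P q) ∧ not (p ==P q)

allFin : ∀ {n} → (Fin n → Bool) → Bool
allFin {zero} p = true
allFin {suc n} p = p zero ∧ allFin (λ i → p (suc i))

anyFin : ∀ {n} → (Fin n → Bool) → Bool
anyFin {zero} p = false
anyFin {suc n} p = p zero ∨ anyFin (λ i → p (suc i))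

allE : ∀ {k} → (Elem k → Bool) → Bool
allE p = allFin (λ i → p (c , i)) ∧ (allFin (λ i → p (ℓ , i)) ∧ allFin (λ i → p (r , i)))

anyE : ∀ {k} → (Elem k → Bool) → Bool
anyE p = anyFin (λ i → p (c , i)) ∨ (anyFin (λ i → p (ℓ , i)) ∨ anyFin (λ i → p (r , i)))

_⇒ᵇ_ : Bool → Bool → Bool
a ⇒ᵇ b = not a ∨ b

Sub : ℕ → Set
Sub k = Vec Bool k × Vec Bool k × Vec Bool k

mem : ∀ {k} → Sub k → Elem k → Bool
mem (vc , vl , vr) (c , i) = lookup vc i
mem (vc , vl , vr) (ℓ , i) = lookup vl i
mem (vc , vl , vr) (r , i) = lookup vr i

fromPred : ∀ {k} → (Elem k → Bool) → Sub k
fromPred p = tabulate (λ i → p (c , i)) , tabulate (λ i → p (ℓ , i)) , tabulate (λ i → p (r , i))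

isIdeal : ∀ {k} → Sub k → Bool
isIdeal I = allE (λ y → mem I y ⇒ᵇ allE (λ x → (x ≤P y) ⇒ᵇ mem I x))

IsOrderIdeal : ∀ {k} → Sub k → Set
IsOrderIdeal I = T (isIdeal I)

minimalOutside : ∀ {k} → Sub k → Elem k → Bool
minimalOutside I y = not (mem I y) ∧ allE (λ x → (x <P y) ⇒ᵇ mem I x)

rowmotion : ∀ {k} → Sub k → Sub k
rowmotion I = fromPred (λ x → anyE (λ y → minimalOutside I y ∧ (x ≤P y)))

iter : {S : Set} → (S → S) → ℕ → S → S
iter φ zero x = x
iter φ (suc n) x = φ (iter φ n x)

-- n is the size of the φ-orbit of x (its least positive period);
-- the orbit is then exactly {φ^j x | j < n}, with these elements distinct.
IsOrbitSize : {S : Set} → (S → S) → S → ℕ → Set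
IsOrbitSize φ x n =
  (0 < n) × (iter φ n x ≡ x) × (∀ m → 0 < m → m < n → iter φ m x ≢ x)

sumTo : ℕ → (ℕ → ℚ) → ℚ
sumTo zero f = 0ℚ
sumTo (suc n) f = sumTo n f + f n

-- g is c-mesic w.r.t. φ on the set {x | D x}: on every orbit, the average
-- (1/#O) Σ_{x∈O} g x equals c, written as Σ_{x∈O} g x = #O · c.
Mesic : {S : Set} → (D : S → Set) → (φ : S → S) → (g : S → ℚ) → (c : ℚ) → Set
Mesic D φ g cst =
  ∀ x → D x → ∀ n → IsOrbitSize φ x n →
    sumTo n (λ j → g (iter φ j x)) ≡ ((+ n) / 1) * cst

χ : ∀ {k} → Elem k → Sub k → ℚ
χ s I = if mem I s then 1ℚ else 0ℚ

{-# OPTIONS --safe #-}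

-- An order ideal of V_k is determined by the heights a ≥ b, d of its c-, ℓ- and r-columns.
-- Record the side columns by clocks L, R ≤ a instead, a clock being 0 when its column is as
-- high as the c-column and b + 1 when it has height b < a. In the coordinates (a , L , R)
-- rowmotion adds 1 to all three numbers while a < k; once the c-column is full it moves to
-- height max L R, resets the larger clock to 0 and advances the other (a tie resets both).
-- Following these runs, k + 2 steps of rowmotion exchange the ℓ- and r-columns, so along
-- every orbit χ_{ℓ_i} and χ_{r_i} have the same sum. For (2), an explicit potential Φ on
-- clock states satisfies Φ(ρ t) - Φ(t) = (k + 2) g(t) - 2(k - 1) for the statistic
-- g = χ_{ℓ_1} + χ_{r_1} - χ_{c_k}, so the orbit sums of (k + 2) g - 2(k - 1) telescope to 0.

module Submission where

open import Defs
open import Data.Bool using (Bool; true; false; T; not; _∧_; if_then_else_)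
open import Data.Bool.Properties using (T-∧; T-∨; T-≡; T-not-≡)
open import Data.Empty using (⊥-elim)
open import Data.Fin using (Fin; zero; suc; toℕ; fromℕ; fromℕ<)
open import Data.Fin.Properties using (toℕ<n; toℕ-fromℕ<; toℕ-injective; toℕ-fromℕ)
open import Data.Integer as ℤ using (ℤ; +_)
import Data.Integer.Properties as ℤ
import Data.Integer.Tactic.RingSolver as ℤ-Solver
open import Data.Nat
  using (ℕ; zero; suc; _+_; _*_; _∸_; _⊔_; _≤_; _<_; z≤n; s≤s; s≤s⁻¹; z<s; _<ᵇ_; _≤ᵇ_; _≡ᵇ_)
open import Data.Nat.Properties
open import Algebra.Properties.CommutativeSemigroup +-commutativeSemigroup
  using (interchange; xy∙z≈xz∙y; x∙yz≈xz∙y)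
open import Data.Nat.Tactic.RingSolver using (solve-∀)
open import Data.Product using (_×_; _,_; proj₁; proj₂; ∃-syntax)
open import Data.Rational as ℚ using (ℚ; 0ℚ; _/_; toℚᵘ)
open import Data.Rational.Properties
  using (toℚᵘ-injective; toℚᵘ-fromℚᵘ; toℚᵘ-homo-+; toℚᵘ-homo-*; toℚᵘ-homo‿-)
import Data.Rational.Properties as ℚ
open import Data.Rational.Solver using (module +-*-Solver)
open import Data.Rational.Unnormalised as ℚᵘ using (mkℚᵘ; *≡*)
import Data.Rational.Unnormalised.Properties as ℚᵘ
open import Data.Sum using (_⊎_; inj₁; inj₂)
open import Data.Sum.Function.Propositional using (_⊎-⇔_)
open import Data.Unit using (⊤; tt)
open import Data.Vec using (Vec; []; _∷_; lookup; tabulate)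
open import Data.Vec.Properties using (lookup∘tabulate; tabulate∘lookup; tabulate-cong)
open import Function using (_∘_)
open import Function.Bundles using (_⇔_; mk⇔; module Equivalence)
open import Function.Construct.Composition using (_⇔-∘_)
open import Function.Construct.Symmetry using (⇔-sym)
open import Relation.Binary.Definitions using (tri<; tri≈; tri>)
open import Relation.Binary.PropositionalEquality
open import Relation.Nullary using (¬_)

open Equivalence using (to; from)

T-injective : ∀ {x y} → (T x ⇔ T y) → x ≡ y
T-injective {false} {false} _   = refl
T-injective {false} {true}  x⇔y = ⊥-elim (from x⇔y tt)
T-injective {true}  {false} x⇔y = ⊥-elim (to x⇔y tt)
T-injective {true}  {true}  _   = refl

T-not : ∀ {x} → T (not x) ⇔ (¬ T x)
T-not {false} = mk⇔ (λ _ ()) (λ _ → tt)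
T-not {true}  = mk⇔ (λ ()) (λ ¬t → ¬t tt)

T-⇒ᵇ : ∀ {x y} → T (x ⇒ᵇ y) ⇔ (T x → T y)
T-⇒ᵇ {false} = mk⇔ (λ _ ()) (λ _ → tt)
T-⇒ᵇ {true}  = mk⇔ (λ t _ → t) (λ f → f tt)

T-<ᵇ : ∀ {m n} → T (m <ᵇ n) ⇔ m < n
T-<ᵇ {m} {n} = mk⇔ (<ᵇ⇒< m n) <⇒<ᵇ

<ᵇ-true : ∀ {m n} → m < n → (m <ᵇ n) ≡ true
<ᵇ-true m<n = to T-≡ (<⇒<ᵇ m<n)

¬T⇒≡false : ∀ {x} → ¬ T x → x ≡ false
¬T⇒≡false ¬x = to T-not-≡ (from T-not ¬x)

<ᵇ-false : ∀ {m n} → ¬ m < n → (m <ᵇ n) ≡ false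
<ᵇ-false {m} {n} m≮n = ¬T⇒≡false (m≮n ∘ <ᵇ⇒< m n)

≡ᵇ-refl : ∀ n → (n ≡ᵇ n) ≡ true
≡ᵇ-refl n = to T-≡ (≡⇒≡ᵇ n n refl)

≡ᵇ-false : ∀ {m n} → m ≢ n → (m ≡ᵇ n) ≡ false
≡ᵇ-false {m} {n} m≢n = ¬T⇒≡false (m≢n ∘ ≡ᵇ⇒≡ m n)

T-allFin : ∀ {n} {p : Fin n → Bool} → T (allFin p) ⇔ (∀ i → T (p i))
T-allFin {zero}      = mk⇔ (λ _ ()) (λ _ → tt)
T-allFin {suc n} {p} = mk⇔ forward backward
  where
  forward : T (allFin p) → ∀ i → T (p i)
  forward h zero    = proj₁ (to (T-∧ {p zero}) h)
  forward h (suc i) = to T-allFin (proj₂ (to (T-∧ {p zero}) h)) i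
  backward : (∀ i → T (p i)) → T (allFin p)
  backward f = from (T-∧ {p zero}) (f zero , from T-allFin (f ∘ suc))

T-anyFin : ∀ {n} {p : Fin n → Bool} → T (anyFin p) ⇔ (∃[ i ] T (p i))
T-anyFin {zero}      = mk⇔ (λ ()) (λ ())
T-anyFin {suc n} {p} = mk⇔ forward backward
  where
  forward : T (anyFin p) → ∃[ i ] T (p i)
  forward h with to (T-∨ {p zero}) h
  ... | inj₁ p0 = zero , p0
  ... | inj₂ ps = let i , pi = to T-anyFin ps in suc i , pi
  backward : ∃[ i ] T (p i) → T (anyFin p)
  backward (zero  , p0) = from (T-∨ {p zero}) (inj₁ p0)
  backward (suc i , pi) = from (T-∨ {p zero}) (inj₂ (from T-anyFin (i , pi)))

module _ {k : ℕ} {p : Elem k → Bool} where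

  private
    pc pℓ pr : Fin k → Bool
    pc i = p (c , i)
    pℓ i = p (ℓ , i)
    pr i = p (r , i)

  T-allE : T (allE p) ⇔ (∀ x → T (p x))
  T-allE = mk⇔ forward backward
    where
    forward : T (allE p) → ∀ x → T (p x)
    forward h (c , i) = to T-allFin (proj₁ (to (T-∧ {allFin pc}) h)) i
    forward h (ℓ , i) = to T-allFin (proj₁ (to (T-∧ {allFin pℓ}) (proj₂ (to (T-∧ {allFin pc}) h)))) i
    forward h (r , i) = to T-allFin (proj₂ (to (T-∧ {allFin pℓ}) (proj₂ (to (T-∧ {allFin pc}) h)))) i
    backward : (∀ x → T (p x)) → T (allE p)
    backward f = from (T-∧ {allFin pc})
      (from T-allFin (f ∘ (c ,_)) , from (T-∧ {allFin pℓ}) (from T-allFin (f ∘ (ℓ ,_)) , from T-allFin (f ∘ (r ,_))))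

  T-anyE : T (anyE p) ⇔ (∃[ x ] T (p x))
  T-anyE = mk⇔ forward backward
    where
    forward : T (anyE p) → ∃[ x ] T (p x)
    forward h with to (T-∨ {anyFin pc}) h
    ... | inj₁ hc = let i , q = to T-anyFin hc in (c , i) , q
    ... | inj₂ h′ with to (T-∨ {anyFin pℓ}) h′
    ...   | inj₁ hℓ = let i , q = to T-anyFin hℓ in (ℓ , i) , q
    ...   | inj₂ hr = let i , q = to T-anyFin hr in (r , i) , q
    backward : ∃[ x ] T (p x) → T (anyE p)
    backward ((c , i) , q) = from (T-∨ {anyFin pc}) (inj₁ (from T-anyFin (i , q)))
    backward ((ℓ , i) , q) = from (T-∨ {anyFin pc}) (inj₂ (from (T-∨ {anyFin pℓ}) (inj₁ (from T-anyFin (i , q)))))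
    backward ((r , i) , q) = from (T-∨ {anyFin pc}) (inj₂ (from (T-∨ {anyFin pℓ}) (inj₂ (from T-anyFin (i , q)))))

≤V-refl : ∀ v → T (v ≤V v)
≤V-refl c = tt
≤V-refl ℓ = tt
≤V-refl r = tt

==V⇒≡ : ∀ v w → T (v ==V w) → v ≡ w
==V⇒≡ c c _ = refl
==V⇒≡ ℓ ℓ _ = refl
==V⇒≡ r r _ = refl
==V⇒≡ c ℓ ()
==V⇒≡ c r ()
==V⇒≡ ℓ c ()
==V⇒≡ ℓ r ()
==V⇒≡ r c ()
==V⇒≡ r ℓ ()

==V-refl : ∀ v → T (v ==V v)
==V-refl c = tt
==V-refl ℓ = tt
==V-refl r = tt

≤c⇒≡c : ∀ {w} → T (w ≤V c) → w ≡ c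
≤c⇒≡c {c} _ = refl
≤c⇒≡c {ℓ} ()
≤c⇒≡c {r} ()

side≤⇒≡ : ∀ {v w} → v ≢ c → T (v ≤V w) → w ≡ v
side≤⇒≡ {c} v≢c _ = ⊥-elim (v≢c refl)
side≤⇒≡ {ℓ} {ℓ} _ _ = refl
side≤⇒≡ {r} {r} _ _ = refl
side≤⇒≡ {ℓ} {c} _ ()
side≤⇒≡ {ℓ} {r} _ ()
side≤⇒≡ {r} {c} _ ()
side≤⇒≡ {r} {ℓ} _ ()

<side⇒≡c : ∀ {v w} → v ≢ c → T (w ≤V v) → w ≢ v → w ≡ c
<side⇒≡c {w = c} _ _ _ = refl
<side⇒≡c {ℓ} {ℓ} _ _ w≢v = ⊥-elim (w≢v refl)
<side⇒≡c {r} {r} _ _ w≢v = ⊥-elim (w≢v refl)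
<side⇒≡c {c} {ℓ} v≢c _ _ = ⊥-elim (v≢c refl)
<side⇒≡c {c} {r} v≢c _ _ = ⊥-elim (v≢c refl)
<side⇒≡c {ℓ} {r} _ () _
<side⇒≡c {r} {ℓ} _ () _

module _ {k : ℕ} {v w : V} {i j : Fin k} where

  T-≤P : T ((v , i) ≤P (w , j)) ⇔ (T (v ≤V w) × toℕ i ≤ toℕ j)
  T-≤P = mk⇔ forward backward
    where
    forward : T ((v , i) ≤P (w , j)) → T (v ≤V w) × toℕ i ≤ toℕ j
    forward h = let v≤w , i≤j = to (T-∧ {v ≤V w}) h in v≤w , ≤ᵇ⇒≤ (toℕ i) (toℕ j) i≤j
    backward : T (v ≤V w) × toℕ i ≤ toℕ j → T ((v , i) ≤P (w , j))
    backward (v≤w , i≤j) = from (T-∧ {v ≤V w}) (v≤w , ≤⇒≤ᵇ i≤j)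

  T-==P : T ((v , i) ==P (w , j)) ⇔ ((v , i) ≡ (w , j))
  T-==P = mk⇔ forward backward
    where
    forward : T ((v , i) ==P (w , j)) → (v , i) ≡ (w , j)
    forward h with to (T-∧ {v ==V w}) h
    ... | v=w , i~j with to (T-∧ {toℕ i ≤ᵇ toℕ j}) i~j
    ... | i≤j , j≤i =
      cong₂ _,_ (==V⇒≡ v w v=w) (toℕ-injective (≤-antisym (≤ᵇ⇒≤ _ _ i≤j) (≤ᵇ⇒≤ _ _ j≤i)))
    backward : (v , i) ≡ (w , j) → T ((v , i) ==P (w , j))
    backward refl = from (T-∧ {v ==V v})
      (==V-refl v , from (T-∧ {toℕ i ≤ᵇ toℕ i}) (≤⇒≤ᵇ (≤-refl {toℕ i}) , ≤⇒≤ᵇ (≤-refl {toℕ i})))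

  T-<P : T ((v , i) <P (w , j)) ⇔ (T ((v , i) ≤P (w , j)) × (v , i) ≢ (w , j))
  T-<P = mk⇔ forward backward
    where
    forward : T ((v , i) <P (w , j)) → T ((v , i) ≤P (w , j)) × (v , i) ≢ (w , j)
    forward h = let le , ne = to (T-∧ {(v , i) ≤P (w , j)}) h in le , to T-not ne ∘ from T-==P
    backward : T ((v , i) ≤P (w , j)) × (v , i) ≢ (w , j) → T ((v , i) <P (w , j))
    backward (le , ne) = from (T-∧ {(v , i) ≤P (w , j)}) (le , from T-not (ne ∘ to T-==P))

  <P-cases : T ((v , i) <P (w , j)) → T (v ≤V w) × (toℕ i < toℕ j ⊎ (toℕ i ≡ toℕ j × v ≢ w))
  <P-cases h with to T-<P h
  ... | le , ne with to T-≤P le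
  ... | v≤w , i≤j with m≤n⇒m<n∨m≡n i≤j
  ...   | inj₁ i<j = v≤w , inj₁ i<j
  ...   | inj₂ i≡j = v≤w , inj₂ (i≡j , λ v≡w → ne (cong₂ _,_ v≡w (toℕ-injective i≡j)))

  <P-intro : T (v ≤V w) → toℕ i ≤ toℕ j → (v , i) ≢ (w , j) → T ((v , i) <P (w , j))
  <P-intro v≤w i≤j ne = from T-<P (from T-≤P (v≤w , i≤j) , ne)

Heights : Set
Heights = V → ℕ

belowHeights : ∀ {k} → Heights → Elem k → Bool
belowHeights h (v , i) = toℕ i <ᵇ h v

heightIdeal : ∀ {k} → Heights → Sub k
heightIdeal h = fromPred (belowHeights h)

Antitone : Heights → Set
Antitone h = ∀ {v w} → T (v ≤V w) → h w ≤ h v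

Exposed : Heights → V → Set
Exposed h v = ∀ w → T (w ≤V v) → w ≢ v → h v < h w

-- The top (u , h u) of column u is a minimal element outside the ideal, at level ≥ i.
Generates : ℕ → Heights → V → ℕ → Set
Generates k h u i = i ≤ h u × h u < k × Exposed h u

Exposed-c : ∀ h → Exposed h c
Exposed-c h w w≤c w≢c = ⊥-elim (w≢c (≤c⇒≡c w≤c))

Exposed-side : ∀ {h v} → v ≢ c → Exposed h v ⇔ h v < h c
Exposed-side {h} {v} v≢c = mk⇔
  (λ exposed → exposed c tt (v≢c ∘ sym))
  (λ hv<hc w w≤v w≢v → subst (λ u → h v < h u) (sym (<side⇒≡c v≢c w≤v w≢v)) hv<hc)

∃-above-side : ∀ {P : V → Set} {v} → v ≢ c → (∃[ u ] T (v ≤V u) × P u) ⇔ P v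
∃-above-side {P} {v} v≢c =
  mk⇔ (λ (u , v≤u , pu) → subst P (side≤⇒≡ v≢c v≤u) pu) (λ pv → v , ≤V-refl v , pv)

∃-above-c : ∀ {P : V → Set} → (∃[ u ] T (c ≤V u) × P u) ⇔ (P c ⊎ P ℓ ⊎ P r)
∃-above-c {P} = mk⇔ forward backward
  where
  forward : (∃[ u ] T (c ≤V u) × P u) → P c ⊎ P ℓ ⊎ P r
  forward (c , _ , p) = inj₁ p
  forward (ℓ , _ , p) = inj₂ (inj₁ p)
  forward (r , _ , p) = inj₂ (inj₂ p)
  backward : P c ⊎ P ℓ ⊎ P r → ∃[ u ] T (c ≤V u) × P u
  backward (inj₁ p)        = c , tt , p
  backward (inj₂ (inj₁ p)) = ℓ , tt , p
  backward (inj₂ (inj₂ p)) = r , tt , p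

mem-fromPred : ∀ {k} (p : Elem k → Bool) x → mem (fromPred p) x ≡ p x
mem-fromPred p (c , i) = lookup∘tabulate (p ∘ (c ,_)) i
mem-fromPred p (ℓ , i) = lookup∘tabulate (p ∘ (ℓ ,_)) i
mem-fromPred p (r , i) = lookup∘tabulate (p ∘ (r ,_)) i

lookup-ext : ∀ {n} {u v : Vec Bool n} → (∀ i → lookup u i ≡ lookup v i) → u ≡ v
lookup-ext {u = u} {v} eq = trans (sym (tabulate∘lookup u)) (trans (tabulate-cong eq) (tabulate∘lookup v))

Sub-ext : ∀ {k} {I J : Sub k} → (∀ x → mem I x ≡ mem J x) → I ≡ J
Sub-ext {I = _ , _ , _} {_ , _ , _} eq =
  cong₂ _,_ (lookup-ext (eq ∘ (c ,_))) (cong₂ _,_ (lookup-ext (eq ∘ (ℓ ,_))) (lookup-ext (eq ∘ (r ,_))))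

T-mem-heightIdeal : ∀ {k} (h : Heights) v (i : Fin k) → T (mem (heightIdeal h) (v , i)) ⇔ toℕ i < h v
T-mem-heightIdeal h v i = mk⇔
  (to T-<ᵇ ∘ subst T (mem-fromPred (belowHeights h) (v , i)))
  (subst T (sym (mem-fromPred (belowHeights h) (v , i))) ∘ from T-<ᵇ)

module _ {k : ℕ} {h : Heights} (antitone : Antitone h) where

  private
    I : Sub k
    I = heightIdeal h

  minimalOutside-heightIdeal : ∀ v (j : Fin k) →
    T (minimalOutside I (v , j)) ⇔ (toℕ j ≡ h v × Exposed h v)
  minimalOutside-heightIdeal v j = mk⇔ forward backward
    where
    closedBelow : Elem k → Bool
    closedBelow x = (x <P (v , j)) ⇒ᵇ mem I x
    forward : T (minimalOutside I (v , j)) → toℕ j ≡ h v × Exposed h v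
    forward min = ≤-antisym j≤hv hv≤j , exposed
      where
      outside : ¬ toℕ j < h v
      outside = to T-not (proj₁ (to (T-∧ {not (mem I (v , j))}) min)) ∘ from (T-mem-heightIdeal h v j)
      below : ∀ x → T (x <P (v , j)) → T (mem I x)
      below x = to T-⇒ᵇ (to (T-allE {p = closedBelow}) (proj₂ (to (T-∧ {not (mem I (v , j))}) min)) x)
      hv≤j : h v ≤ toℕ j
      hv≤j = ≮⇒≥ outside
      j≤hv : toℕ j ≤ h v
      j≤hv = ≮⇒≥ λ hv<j →
        let hv<k = <-trans hv<j (toℕ<n j)
            i≡hv = toℕ-fromℕ< hv<k
            i<j = subst (_< toℕ j) (sym i≡hv) hv<j
        in <-irrefl i≡hv (to (T-mem-heightIdeal h v (fromℕ< hv<k))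
             (below (v , fromℕ< hv<k)
               (<P-intro (≤V-refl v) (<⇒≤ i<j) (λ eq → <-irrefl (cong (toℕ ∘ proj₂) eq) i<j))))
      exposed : Exposed h v
      exposed w w≤v w≢v = subst (_< h w) (≤-antisym j≤hv hv≤j)
        (to (T-mem-heightIdeal h w j) (below (w , j) (<P-intro w≤v (≤-refl {toℕ j}) (w≢v ∘ cong proj₁))))
    backward : toℕ j ≡ h v × Exposed h v → T (minimalOutside I (v , j))
    backward (j≡hv , exposed) = from (T-∧ {not (mem I (v , j))})
      ( from T-not (<-irrefl j≡hv ∘ to (T-mem-heightIdeal h v j))
      , from (T-allE {p = closedBelow}) (λ x → from T-⇒ᵇ (below x)))
      where
      below : ∀ x → T (x <P (v , j)) → T (mem I x)
      below (w , i) lt with <P-cases lt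
      ... | w≤v , inj₁ i<j =
        from (T-mem-heightIdeal h w i) (<-≤-trans (subst (toℕ i <_) j≡hv i<j) (antitone w≤v))
      ... | w≤v , inj₂ (i≡j , w≢v) =
        from (T-mem-heightIdeal h w i) (subst (_< h w) (sym (trans i≡j j≡hv)) (exposed w w≤v w≢v))

  rowmotion-heightIdeal : ∀ w (i : Fin k) →
    T (mem (rowmotion I) (w , i)) ⇔ (∃[ v ] T (w ≤V v) × Generates k h v (toℕ i))
  rowmotion-heightIdeal w i = mk⇔ forward backward
    where
    generators : Elem k → Bool
    generators y = minimalOutside I y ∧ ((w , i) ≤P y)
    unfold : mem (rowmotion I) (w , i) ≡ anyE generators
    unfold = mem-fromPred (λ x → anyE (λ y → minimalOutside I y ∧ (x ≤P y))) (w , i)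
    forward : T (mem (rowmotion I) (w , i)) → ∃[ v ] T (w ≤V v) × Generates k h v (toℕ i)
    forward m with to (T-anyE {p = generators}) (subst T unfold m)
    ... | (v , j) , q with to (T-∧ {minimalOutside I (v , j)}) q
    ... | min , le with to (minimalOutside-heightIdeal v j) min | to T-≤P le
    ... | j≡hv , exposed | w≤v , i≤j =
      v , w≤v , subst (toℕ i ≤_) j≡hv i≤j , subst (_< k) j≡hv (toℕ<n j) , exposed
    backward : (∃[ v ] T (w ≤V v) × Generates k h v (toℕ i)) → T (mem (rowmotion I) (w , i))
    backward (v , w≤v , i≤hv , hv<k , exposed) = subst T (sym unfold) (from (T-anyE {p = generators}) ((v , j) ,
      from (T-∧ {minimalOutside I (v , j)})
        ( from (minimalOutside-heightIdeal v j) (j≡hv , exposed)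
        , from T-≤P (w≤v , subst (toℕ i ≤_) (sym j≡hv) i≤hv))))
      where
      j : Fin k
      j = fromℕ< hv<k
      j≡hv : toℕ j ≡ h v
      j≡hv = toℕ-fromℕ< hv<k

-- Clock coordinates

State : Set
State = ℕ × ℕ × ℕ

Valid : ℕ → State → Set
Valid k (a , L , R) = L ≤ a × R ≤ a × a ≤ k

sideHeight : ℕ → ℕ → ℕ
sideHeight a zero    = a
sideHeight a (suc b) = b

heights : State → Heights
heights (a , L , R) c = a
heights (a , L , R) ℓ = sideHeight a L
heights (a , L , R) r = sideHeight a R

idealOf : ∀ {k} → State → Sub k
idealOf t = heightIdeal (heights t)

wrap : ℕ → ℕ → State
wrap L R = if R <ᵇ L then (L , 0 , suc R) else if L <ᵇ R then (R , suc L , 0) else (L , 0 , 0)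

step : ℕ → State → State
step k (a , L , R) = if a <ᵇ k then (suc a , suc L , suc R) else wrap L R

swap : State → State
swap (a , L , R) = a , R , L

wrap-> : ∀ {L R} → R < L → wrap L R ≡ (L , 0 , suc R)
wrap-> R<L rewrite <ᵇ-true R<L = refl

wrap-< : ∀ {L R} → L < R → wrap L R ≡ (R , suc L , 0)
wrap-< L<R rewrite <ᵇ-false (<⇒≯ L<R) | <ᵇ-true L<R = refl

wrap-≡ : ∀ L → wrap L L ≡ (L , 0 , 0)
wrap-≡ L rewrite <ᵇ-false (<-irrefl (refl {x = L})) = refl

step-< : ∀ {k a L R} → a < k → step k (a , L , R) ≡ (suc a , suc L , suc R)
step-< a<k rewrite <ᵇ-true a<k = refl

step-≡ : ∀ {k a L R} → a ≡ k → step k (a , L , R) ≡ wrap L R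
step-≡ {k} refl rewrite <ᵇ-false (<-irrefl (refl {x = k})) = refl

wrap-swap : ∀ L R → wrap R L ≡ swap (wrap L R)
wrap-swap L R with <-cmp L R
... | tri< L<R _ _ rewrite wrap-< L<R | wrap-> L<R = refl
... | tri≈ _ refl _ rewrite wrap-≡ L = refl
... | tri> _ _ R<L rewrite wrap-> R<L | wrap-< R<L = refl

step-swap : ∀ k t → step k (swap t) ≡ swap (step k t)
step-swap k (a , L , R) with a <ᵇ k
... | true  = refl
... | false = wrap-swap L R

valid-step : ∀ {k t} → Valid k t → Valid k (step k t)
valid-step {k} {a , L , R} (L≤a , R≤a , a≤k) with m≤n⇒m<n∨m≡n a≤k
... | inj₁ a<k rewrite step-< {L = L} {R} a<k = s≤s L≤a , s≤s R≤a , a<k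
... | inj₂ a≡k rewrite step-≡ {L = L} {R} a≡k with <-cmp L R
...   | tri< L<R _ _ rewrite wrap-< L<R = L<R , z≤n , ≤-trans R≤a a≤k
...   | tri≈ _ refl _ rewrite wrap-≡ L = z≤n , z≤n , ≤-trans L≤a a≤k
...   | tri> _ _ R<L rewrite wrap-> R<L = z≤n , R<L , ≤-trans L≤a a≤k

clock : State → V → ℕ
clock (a , L , R) c = a
clock (a , L , R) ℓ = L
clock (a , L , R) r = R

heights-wrap : ∀ L R v → heights (wrap L R) v ≡ clock (L ⊔ R , L , R) v
heights-wrap L R c with <-cmp L R
... | tri< L<R _ _ rewrite wrap-< L<R = sym (m≤n⇒m⊔n≡n (<⇒≤ L<R))
... | tri≈ _ refl _ rewrite wrap-≡ L = sym (⊔-idem L)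
... | tri> _ _ R<L rewrite wrap-> R<L = sym (m≥n⇒m⊔n≡m (<⇒≤ R<L))
heights-wrap L R ℓ with <-cmp L R
... | tri< L<R _ _ rewrite wrap-< L<R = refl
... | tri≈ _ refl _ rewrite wrap-≡ L = refl
... | tri> _ _ R<L rewrite wrap-> R<L = refl
heights-wrap L R r with <-cmp L R
... | tri< L<R _ _ rewrite wrap-< L<R = refl
... | tri≈ _ refl _ rewrite wrap-≡ L = refl
... | tri> _ _ R<L rewrite wrap-> R<L = refl

heights-step-side : ∀ {k t v} → Valid k t → v ≢ c → heights (step k t) v ≡ clock t v
heights-step-side {v = c} _ c≢c = ⊥-elim (c≢c refl)
heights-step-side {k} {a , L , R} {ℓ} (_ , _ , a≤k) _ with m≤n⇒m<n∨m≡n a≤k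
... | inj₁ a<k rewrite step-< {L = L} {R} a<k = refl
... | inj₂ a≡k rewrite step-≡ {L = L} {R} a≡k = heights-wrap L R ℓ
heights-step-side {k} {a , L , R} {r} (_ , _ , a≤k) _ with m≤n⇒m<n∨m≡n a≤k
... | inj₁ a<k rewrite step-< {L = L} {R} a<k = refl
... | inj₂ a≡k rewrite step-≡ {L = L} {R} a≡k = heights-wrap L R r

sideHeight≤ : ∀ {a L} → L ≤ a → sideHeight a L ≤ a
sideHeight≤ {L = zero}  _   = ≤-refl
sideHeight≤ {L = suc b} b<a = <⇒≤ b<a

sideHeight-exposed : ∀ {a L i} → L ≤ a → (i ≤ sideHeight a L × sideHeight a L < a) ⇔ i < L
sideHeight-exposed {L = zero}  _   = mk⇔ (λ (_ , a<a) → ⊥-elim (<-irrefl refl a<a)) (λ ())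
sideHeight-exposed {L = suc b} b<a = mk⇔ (λ (i≤b , _) → s≤s i≤b) (λ i<L → s≤s⁻¹ i<L , b<a)

heights-antitone : ∀ {k t} → Valid k t → Antitone (heights t)
heights-antitone {t = a , L , R} (L≤a , R≤a , _) = antitone
  where
  antitone : Antitone (heights (a , L , R))
  antitone {c} {c} _ = ≤-refl
  antitone {c} {ℓ} _ = sideHeight≤ L≤a
  antitone {c} {r} _ = sideHeight≤ R≤a
  antitone {ℓ} {ℓ} _ = ≤-refl
  antitone {r} {r} _ = ≤-refl
  antitone {ℓ} {c} ()
  antitone {ℓ} {r} ()
  antitone {r} {c} ()
  antitone {r} {ℓ} ()

module _ {k a L R} (valid : Valid k (a , L , R)) where

  private
    t : State
    t = a , L , R
    h : Heights
    h = heights t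
    L≤a : L ≤ a
    L≤a = proj₁ valid
    R≤a : R ≤ a
    R≤a = proj₁ (proj₂ valid)
    a≤k : a ≤ k
    a≤k = proj₂ (proj₂ valid)

  generates-c : ∀ {i} → Generates k h c i ⇔ (i ≤ a × a < k)
  generates-c = mk⇔ (λ (i≤a , a<k , _) → i≤a , a<k) (λ (i≤a , a<k) → i≤a , a<k , Exposed-c h)

  generates-side : ∀ {v i} → v ≢ c → Generates k h v i ⇔ i < clock t v
  generates-side {c} c≢c = ⊥-elim (c≢c refl)
  generates-side {ℓ} ℓ≢c = mk⇔
    (λ (i≤b , _ , exposed) → to (sideHeight-exposed L≤a) (i≤b , to (Exposed-side ℓ≢c) exposed))
    (λ i<L → let i≤b , b<a = from (sideHeight-exposed L≤a) i<L
             in i≤b , <-≤-trans b<a a≤k , from (Exposed-side ℓ≢c) b<a)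
  generates-side {r} r≢c = mk⇔
    (λ (i≤d , _ , exposed) → to (sideHeight-exposed R≤a) (i≤d , to (Exposed-side r≢c) exposed))
    (λ i<R → let i≤d , d<a = from (sideHeight-exposed R≤a) i<R
             in i≤d , <-≤-trans d<a a≤k , from (Exposed-side r≢c) d<a)

  new-c-height : ∀ {i} → ((i ≤ a × a < k) ⊎ (i < L ⊎ i < R)) ⇔ i < heights (step k t) c
  new-c-height {i} with m≤n⇒m<n∨m≡n a≤k
  ... | inj₁ a<k rewrite step-< {L = L} {R} a<k = mk⇔ forward (λ i<1+a → inj₁ (s≤s⁻¹ i<1+a , a<k))
    where
    forward : (i ≤ a × a < k) ⊎ (i < L ⊎ i < R) → i < suc a
    forward (inj₁ (i≤a , _))  = s≤s i≤a
    forward (inj₂ (inj₁ i<L)) = <-≤-trans i<L (m≤n⇒m≤1+n L≤a)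
    forward (inj₂ (inj₂ i<R)) = <-≤-trans i<R (m≤n⇒m≤1+n R≤a)
  ... | inj₂ a≡k rewrite step-≡ {L = L} {R} a≡k | heights-wrap L R c = mk⇔ forward backward
    where
    forward : (i ≤ a × a < k) ⊎ (i < L ⊎ i < R) → i < L ⊔ R
    forward (inj₁ (_ , a<k))  = ⊥-elim (<-irrefl a≡k a<k)
    forward (inj₂ (inj₁ i<L)) = m<n⇒m<n⊔o R i<L
    forward (inj₂ (inj₂ i<R)) = m<n⇒m<o⊔n L i<R
    backward : i < L ⊔ R → (i ≤ a × a < k) ⊎ (i < L ⊎ i < R)
    backward i<L⊔R with ⊔-sel L R
    ... | inj₁ L⊔R≡L = inj₂ (inj₁ (subst (i <_) L⊔R≡L i<L⊔R))
    ... | inj₂ L⊔R≡R = inj₂ (inj₂ (subst (i <_) L⊔R≡R i<L⊔R))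

  rowmotion-side : ∀ {v i} → v ≢ c → (∃[ u ] T (v ≤V u) × Generates k h u i) ⇔ i < heights (step k t) v
  rowmotion-side {v} {i} v≢c = subst (λ n → (∃[ u ] T (v ≤V u) × Generates k h u i) ⇔ i < n)
    (sym (heights-step-side valid v≢c)) (generates-side v≢c ⇔-∘ ∃-above-side {P = λ u → Generates k h u i} v≢c)

  rowmotion-column : ∀ w {i} → (∃[ u ] T (w ≤V u) × Generates k h u i) ⇔ i < heights (step k t) w
  rowmotion-column c =
    new-c-height ⇔-∘ ((generates-c ⊎-⇔ (generates-side (λ ()) ⊎-⇔ generates-side (λ ()))) ⇔-∘ ∃-above-c)
  rowmotion-column ℓ = rowmotion-side (λ ())
  rowmotion-column r = rowmotion-side (λ ())

rowmotion-idealOf : ∀ {k t} → Valid k t → rowmotion {k} (idealOf t) ≡ idealOf (step k t)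
rowmotion-idealOf {k} {t@(a , L , R)} valid = Sub-ext λ (w , i) → T-injective
  (⇔-sym (T-mem-heightIdeal (heights (step k t)) w i)
    ⇔-∘ (rowmotion-column valid w ⇔-∘ rowmotion-heightIdeal (heights-antitone valid) w i))

prefixLength : ∀ {n} → Vec Bool n → ℕ
prefixLength []          = 0
prefixLength (true ∷ v)  = suc (prefixLength v)
prefixLength (false ∷ _) = 0

prefixLength≤ : ∀ {n} (v : Vec Bool n) → prefixLength v ≤ n
prefixLength≤ []          = z≤n
prefixLength≤ (true ∷ v)  = s≤s (prefixLength≤ v)
prefixLength≤ (false ∷ _) = z≤n

DownClosed : ∀ {n} → Vec Bool n → Set
DownClosed v = ∀ i j → toℕ i ≤ toℕ j → T (lookup v j) → T (lookup v i)

lookup-prefixLength : ∀ {n} (v : Vec Bool n) → DownClosed v → ∀ i → lookup v i ≡ (toℕ i <ᵇ prefixLength v)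
lookup-prefixLength (true ∷ v)  closed zero    = refl
lookup-prefixLength (true ∷ v)  closed (suc i) =
  lookup-prefixLength v (λ i j i≤j → closed (suc i) (suc j) (s≤s i≤j)) i
lookup-prefixLength (false ∷ v) closed zero    = refl
lookup-prefixLength (false ∷ v) closed (suc i) = ¬T⇒≡false (closed zero (suc i) z≤n)

prefixLength-tabulate : ∀ {n} m → m ≤ n → prefixLength (tabulate {n = n} (λ i → toℕ i <ᵇ m)) ≡ m
prefixLength-tabulate {zero}  zero    z≤n       = refl
prefixLength-tabulate {suc n} zero    _         = refl
prefixLength-tabulate {suc n} (suc m) (s≤s m≤n) = cong suc (prefixLength-tabulate m m≤n)

column : ∀ {k} → Sub k → V → Vec Bool k
column (vc , vℓ , vr) c = vc
column (vc , vℓ , vr) ℓ = vℓ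
column (vc , vℓ , vr) r = vr

mem-column : ∀ {k} (I : Sub k) v i → mem I (v , i) ≡ lookup (column I v) i
mem-column (_ , _ , _) c i = refl
mem-column (_ , _ , _) ℓ i = refl
mem-column (_ , _ , _) r i = refl

columnHeight : ∀ {k} → Sub k → Heights
columnHeight I v = prefixLength (column I v)

ideal-downward : ∀ {k} {I : Sub k} → IsOrderIdeal I → ∀ {x y} → T (x ≤P y) → T (mem I y) → T (mem I x)
ideal-downward {I = I} ideal {x} {y} x≤y y∈I =
  to T-⇒ᵇ (to (T-allE {p = λ z → (z ≤P y) ⇒ᵇ mem I z})
    (to T-⇒ᵇ (to (T-allE {p = λ z → mem I z ⇒ᵇ allE (λ w → (w ≤P z) ⇒ᵇ mem I w)}) ideal y) y∈I) x) x≤y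

module _ {k} {I : Sub k} (ideal : IsOrderIdeal I) where

  column-downClosed : ∀ v → DownClosed (column I v)
  column-downClosed v i j i≤j j∈I = subst T (mem-column I v i)
    (ideal-downward {I = I} ideal {v , i} {v , j} (from T-≤P (≤V-refl v , i≤j)) (subst T (sym (mem-column I v j)) j∈I))

  mem-columnHeight : ∀ v i → mem I (v , i) ≡ (toℕ i <ᵇ columnHeight I v)
  mem-columnHeight v i = trans (mem-column I v i) (lookup-prefixLength (column I v) (column-downClosed v) i)

  columnHeight-antitone : Antitone (columnHeight I)
  columnHeight-antitone {v} {w} v≤w = ≮⇒≥ λ hv<hw →
    let hv<k = <-≤-trans hv<hw (prefixLength≤ (column I w))
        i = fromℕ< hv<k
        i≡hv = toℕ-fromℕ< hv<k
        wi∈I = subst T (sym (mem-columnHeight w i)) (<⇒<ᵇ (subst (_< columnHeight I w) (sym i≡hv) hv<hw))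
        vi∈I = ideal-downward {I = I} ideal {v , i} {w , i} (from T-≤P (v≤w , ≤-refl {toℕ i})) wi∈I
    in <-irrefl i≡hv (<ᵇ⇒< (toℕ i) (columnHeight I v) (subst T (mem-columnHeight v i) vi∈I))

sideClock : ℕ → ℕ → ℕ
sideClock a b = if b <ᵇ a then suc b else 0

sideClock≤ : ∀ {a b} → b ≤ a → sideClock a b ≤ a
sideClock≤ {a} {b} b≤a with m≤n⇒m<n∨m≡n b≤a
... | inj₁ b<a rewrite <ᵇ-true b<a = b<a
... | inj₂ refl rewrite <ᵇ-false (<-irrefl (refl {x = b})) = z≤n

sideHeight-sideClock : ∀ {a b} → b ≤ a → sideHeight a (sideClock a b) ≡ b
sideHeight-sideClock {a} {b} b≤a with m≤n⇒m<n∨m≡n b≤a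
... | inj₁ b<a rewrite <ᵇ-true b<a = refl
... | inj₂ refl rewrite <ᵇ-false (<-irrefl (refl {x = b})) = refl

sideClock-sideHeight : ∀ {a L} → L ≤ a → sideClock a (sideHeight a L) ≡ L
sideClock-sideHeight {a} {zero}  _   rewrite <ᵇ-false (<-irrefl (refl {x = a})) = refl
sideClock-sideHeight {a} {suc b} b<a rewrite <ᵇ-true b<a = refl

stateOf : ∀ {k} → Sub k → State
stateOf I = a , sideClock a (columnHeight I ℓ) , sideClock a (columnHeight I r)
  where
  a : ℕ
  a = columnHeight I c

module _ {k} {I : Sub k} (ideal : IsOrderIdeal I) where

  valid-stateOf : Valid k (stateOf I)
  valid-stateOf = sideClock≤ (columnHeight-antitone {I = I} ideal {c} {ℓ} tt) ,
                  sideClock≤ (columnHeight-antitone {I = I} ideal {c} {r} tt) ,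
                  prefixLength≤ (column I c)

  heights-stateOf : ∀ v → heights (stateOf I) v ≡ columnHeight I v
  heights-stateOf c = refl
  heights-stateOf ℓ = sideHeight-sideClock (columnHeight-antitone {I = I} ideal {c} {ℓ} tt)
  heights-stateOf r = sideHeight-sideClock (columnHeight-antitone {I = I} ideal {c} {r} tt)

  idealOf-stateOf : idealOf (stateOf I) ≡ I
  idealOf-stateOf = Sub-ext λ (v , i) → trans (mem-fromPred (belowHeights (heights (stateOf I))) (v , i))
    (trans (cong (toℕ i <ᵇ_) (heights-stateOf v)) (sym (mem-columnHeight {I = I} ideal v i)))

stateOf-idealOf : ∀ {k t} → Valid k t → stateOf {k} (idealOf t) ≡ t
stateOf-idealOf {k} {a , L , R} (L≤a , R≤a , a≤k)
  rewrite prefixLength-tabulate {k} a a≤k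
        | prefixLength-tabulate {k} (sideHeight a L) (≤-trans (sideHeight≤ L≤a) a≤k)
        | prefixLength-tabulate {k} (sideHeight a R) (≤-trans (sideHeight≤ R≤a) a≤k)
        | sideClock-sideHeight L≤a
        | sideClock-sideHeight R≤a = refl

-- Period k + 2 up to exchanging ℓ and r

iter-+ : ∀ {S : Set} (f : S → S) m n x → iter f (m + n) x ≡ iter f m (iter f n x)
iter-+ f zero    n x = refl
iter-+ f (suc m) n x = cong f (iter-+ f m n x)

iter-preserves : ∀ {S : Set} {P : S → Set} (f : S → S) →
  (∀ {x} → P x → P (f x)) → ∀ n {x} → P x → P (iter f n x)
iter-preserves f pres zero    px = px
iter-preserves {P = P} f pres (suc n) {x} px = pres {iter f n x} (iter-preserves {P = P} f pres n px)

iter-intertwine : ∀ {S S′ : Set} {P : S → Set} (f : S → S) (f′ : S′ → S′) (g : S → S′) →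
  (∀ {x} → P x → P (f x)) → (∀ {x} → P x → f′ (g x) ≡ g (f x)) →
  ∀ n {x} → P x → iter f′ n (g x) ≡ g (iter f n x)
iter-intertwine f f′ g pres comm zero    px = refl
iter-intertwine {P = P} f f′ g pres comm (suc n) {x} px =
  trans (cong f′ (iter-intertwine {P = P} f f′ g pres comm n px)) (comm {iter f n x} (iter-preserves {P = P} f pres n px))

iter-periodic : ∀ {S : Set} (f : S → S) {n x} → iter f n x ≡ x → ∀ j → iter f (n + j) x ≡ iter f j x
iter-periodic f {n} {x} closes j = begin
  iter f (n + j) x       ≡⟨ cong (λ m → iter f m x) (+-comm n j) ⟩
  iter f (j + n) x       ≡⟨ iter-+ f j n x ⟩
  iter f j (iter f n x)  ≡⟨ cong (iter f j) closes ⟩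
  iter f j x             ∎
  where open ≡-Reasoning


module _ {k : ℕ} where

  climb : ∀ s {a L R} → s + a ≤ k → iter (step k) s (a , L , R) ≡ (s + a , s + L , s + R)
  climb zero    _      = refl
  climb (suc s) s+a<k = trans (cong (step k) (climb s (<⇒≤ s+a<k))) (step-< s+a<k)

  run : ∀ s {a L R} → s + a ≡ k → iter (step k) (suc s) (a , L , R) ≡ wrap (s + L) (s + R)
  run s s+a≡k = trans (cong (step k) (climb s (≤-reflexive s+a≡k))) (step-≡ s+a≡k)

period-> : ∀ R p q s → let L = suc (R + p) ; a = L + q ; k = a + s in
  iter (step k) (2 + k) (a , L , R) ≡ (a , R , L)
period-> R p q s = begin
  iter f (2 + k) t₀                                               ≡⟨ cong (λ n → iter f n t₀) (count R p q s) ⟩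
  iter f (R + (suc p + (suc q + suc s))) t₀                       ≡⟨ iter-+ f R _ t₀ ⟩
  iter f R (iter f (suc p + (suc q + suc s)) t₀)                  ≡⟨ cong (iter f R) (iter-+ f (suc p) _ t₀) ⟩
  iter f R (iter f (suc p) (iter f (suc q + suc s) t₀))
    ≡⟨ cong (iter f R ∘ iter f (suc p)) (iter-+ f (suc q) (suc s) t₀) ⟩
  iter f R (iter f (suc p) (iter f (suc q) (iter f (suc s) t₀)))
    ≡⟨ cong (iter f R ∘ iter f (suc p) ∘ iter f (suc q)) phase₁ ⟩
  iter f R (iter f (suc p) (iter f (suc q) t₁))                   ≡⟨ cong (iter f R ∘ iter f (suc p)) phase₂ ⟩
  iter f R (iter f (suc p) t₂)                                    ≡⟨ cong (iter f R) phase₃ ⟩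
  iter f R t₃                                                     ≡⟨ phase₄ ⟩
  (a , R , L)                                                     ∎
  where
  open ≡-Reasoning
  L a k : ℕ
  L = suc (R + p)
  a = L + q
  k = a + s
  f : State → State
  f = step k
  t₀ t₁ t₂ t₃ : State
  t₀ = a , L , R
  t₁ = s + L , 0 , suc (s + R)
  t₂ = q + suc (s + R) , suc q , 0
  t₃ = p + suc q , 0 , suc p
  count : ∀ R p q s → 2 + (suc (R + p) + q + s) ≡ R + (suc p + (suc q + suc s))
  count = solve-∀
  e₁ : ∀ R p q s → s + (suc (R + p) + q) ≡ suc (R + p) + q + s
  e₁ = solve-∀
  e₂ : ∀ R p q s → q + (s + suc (R + p)) ≡ suc (R + p) + q + s
  e₂ = solve-∀
  e₃ : ∀ R p q s → p + (q + suc (s + R)) ≡ suc (R + p) + q + s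
  e₃ = solve-∀
  e₄ : ∀ R p q → R + (p + suc q) ≡ suc (R + p) + q
  e₄ = solve-∀
  phase₁ : iter f (suc s) t₀ ≡ t₁
  phase₁ = trans (run s (e₁ R p q s)) (wrap-> (+-monoʳ-< s (s≤s (m≤m+n R p))))
  phase₂ : iter f (suc q) t₁ ≡ t₂
  phase₂ = trans (run q (e₂ R p q s)) (trans (cong (λ x → wrap x (q + suc (s + R))) (+-identityʳ q))
                 (wrap-< (m<m+n q z<s)))
  phase₃ : iter f (suc p) t₂ ≡ t₃
  phase₃ = trans (run p (e₃ R p q s)) (trans (cong (wrap (p + suc q)) (+-identityʳ p)) (wrap-> (m<m+n p z<s)))
  phase₄ : iter f R t₃ ≡ (a , R , L)
  phase₄ = trans (climb R (≤-trans (≤-reflexive (e₄ R p q)) (m≤m+n a s)))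
                 (cong₂ _,_ (e₄ R p q) (cong₂ _,_ (+-identityʳ R) (+-suc R p)))

period-≡ : ∀ L q s → let a = L + q ; k = a + s in
  iter (step k) (2 + k) (a , L , L) ≡ (a , L , L)
period-≡ L q s = begin
  iter f (2 + k) t₀                              ≡⟨ cong (λ n → iter f n t₀) (count L q s) ⟩
  iter f (L + (suc q + suc s)) t₀                ≡⟨ iter-+ f L _ t₀ ⟩
  iter f L (iter f (suc q + suc s) t₀)           ≡⟨ cong (iter f L) (iter-+ f (suc q) (suc s) t₀) ⟩
  iter f L (iter f (suc q) (iter f (suc s) t₀))  ≡⟨ cong (iter f L ∘ iter f (suc q)) phase₁ ⟩
  iter f L (iter f (suc q) t₁)                   ≡⟨ cong (iter f L) phase₂ ⟩
  iter f L t₂                                    ≡⟨ phase₃ ⟩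
  (a , L , L)                                    ∎
  where
  open ≡-Reasoning
  a k : ℕ
  a = L + q
  k = a + s
  f : State → State
  f = step k
  t₀ t₁ t₂ : State
  t₀ = a , L , L
  t₁ = s + L , 0 , 0
  t₂ = q , 0 , 0
  count : ∀ L q s → 2 + (L + q + s) ≡ L + (suc q + suc s)
  count = solve-∀
  e₁ : ∀ L q s → s + (L + q) ≡ L + q + s
  e₁ = solve-∀
  e₂ : ∀ L q s → q + (s + L) ≡ L + q + s
  e₂ = solve-∀
  phase₁ : iter f (suc s) t₀ ≡ t₁
  phase₁ = trans (run s (e₁ L q s)) (wrap-≡ (s + L))
  phase₂ : iter f (suc q) t₁ ≡ t₂
  phase₂ = trans (run q (e₂ L q s)) (trans (cong (λ x → wrap x x) (+-identityʳ q)) (wrap-≡ q))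
  phase₃ : iter f L t₂ ≡ (a , L , L)
  phase₃ = trans (climb L (m≤m+n a s)) (cong₂ _,_ refl (cong₂ _,_ (+-identityʳ L) (+-identityʳ L)))

iter-swap : ∀ k n t → iter (step k) n (swap t) ≡ swap (iter (step k) n t)
iter-swap k n t = iter-intertwine {P = λ _ → ⊤} (step k) (step k) swap (λ _ → tt) (λ {t} _ → step-swap k t) n tt

period-ordered : ∀ {k a L R} → R < L → L ≤ a → a ≤ k → iter (step k) (2 + k) (a , L , R) ≡ (a , R , L)
period-ordered R<L L≤a a≤k with m≤n⇒∃[o]m+o≡n R<L
... | p , refl with m≤n⇒∃[o]m+o≡n L≤a
...   | q , refl with m≤n⇒∃[o]m+o≡n a≤k
...     | s , refl = period-> _ p q s

period : ∀ {k t} → Valid k t → iter (step k) (2 + k) t ≡ swap t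
period {k} {a , L , R} (L≤a , R≤a , a≤k) with <-cmp L R
... | tri> _ _ R<L = period-ordered R<L L≤a a≤k
... | tri< L<R _ _ = trans (iter-swap k (2 + k) (a , R , L)) (cong swap (period-ordered L<R R≤a a≤k))
... | tri≈ _ refl _ with m≤n⇒∃[o]m+o≡n L≤a
...   | q , refl with m≤n⇒∃[o]m+o≡n a≤k
...     | s , refl = period-≡ L q s

sumℕ : ℕ → (ℕ → ℕ) → ℕ
sumℕ zero    f = 0
sumℕ (suc n) f = sumℕ n f + f n

sumℕ-cong : ∀ n {f g : ℕ → ℕ} → (∀ j → f j ≡ g j) → sumℕ n f ≡ sumℕ n g
sumℕ-cong zero    f≗g = refl
sumℕ-cong (suc n) f≗g = cong₂ _+_ (sumℕ-cong n f≗g) (f≗g n)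

sumℕ-+ : ∀ n (f g : ℕ → ℕ) → sumℕ n (λ j → f j + g j) ≡ sumℕ n f + sumℕ n g
sumℕ-+ zero    f g = refl
sumℕ-+ (suc n) f g = trans (cong (_+ (f n + g n)) (sumℕ-+ n f g)) (interchange (sumℕ n f) (sumℕ n g) (f n) (g n))

sumℕ-*ˡ : ∀ n m (f : ℕ → ℕ) → sumℕ n (λ j → m * f j) ≡ m * sumℕ n f
sumℕ-*ˡ zero    m f = sym (*-zeroʳ m)
sumℕ-*ˡ (suc n) m f = trans (cong (_+ m * f n) (sumℕ-*ˡ n m f)) (sym (*-distribˡ-+ m (sumℕ n f) (f n)))

sumℕ-const : ∀ n m → sumℕ n (λ _ → m) ≡ n * m
sumℕ-const zero    m = refl
sumℕ-const (suc n) m = trans (cong (_+ m) (sumℕ-const n m)) (+-comm (n * m) m)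

sumℕ-unfoldˡ : ∀ n (f : ℕ → ℕ) → f 0 + sumℕ n (f ∘ suc) ≡ sumℕ n f + f n
sumℕ-unfoldˡ zero    f = +-comm (f 0) 0
sumℕ-unfoldˡ (suc n) f = trans (sym (+-assoc (f 0) _ (f (suc n)))) (cong (_+ f (suc n)) (sumℕ-unfoldˡ n f))

sumℕ-rotate : ∀ n (f : ℕ → ℕ) → f n ≡ f 0 → sumℕ n (f ∘ suc) ≡ sumℕ n f
sumℕ-rotate n f fn≡f0 = +-cancelˡ-≡ (f 0) _ _ (begin
  f 0 + sumℕ n (f ∘ suc)  ≡⟨ sumℕ-unfoldˡ n f ⟩
  sumℕ n f + f n          ≡⟨ cong (λ u → sumℕ n f + u) fn≡f0 ⟩
  sumℕ n f + f 0          ≡⟨ +-comm (sumℕ n f) (f 0) ⟩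
  f 0 + sumℕ n f          ∎)
  where open ≡-Reasoning

sumℕ-periodic : ∀ n (f : ℕ → ℕ) → (∀ j → f (n + j) ≡ f j) →
  ∀ s → sumℕ n (λ j → f (s + j)) ≡ sumℕ n f
sumℕ-periodic n f periodic zero    = refl
sumℕ-periodic n f periodic (suc s) =
  trans (sumℕ-periodic n (f ∘ suc) periodic′ s) (sumℕ-rotate n f (trans (cong f (sym (+-identityʳ n))) (periodic 0)))
  where
  periodic′ : ∀ j → f (suc (n + j)) ≡ f (suc j)
  periodic′ j = trans (cong f (sym (+-suc n j))) (periodic (suc j))

telescope : ∀ (P A B : ℕ → ℕ) → (∀ j → P (suc j) + A j ≡ P j + B j) →
  ∀ n → P n + sumℕ n A ≡ P 0 + sumℕ n B
telescope P A B coboundary zero    = refl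
telescope P A B coboundary (suc n) = begin
  P (suc n) + (sumℕ n A + A n)  ≡⟨ x∙yz≈xz∙y (P (suc n)) (sumℕ n A) (A n) ⟩
  P (suc n) + A n + sumℕ n A    ≡⟨ cong (_+ sumℕ n A) (coboundary n) ⟩
  P n + B n + sumℕ n A          ≡⟨ xy∙z≈xz∙y (P n) (B n) (sumℕ n A) ⟩
  P n + sumℕ n A + B n          ≡⟨ cong (_+ B n) (telescope P A B coboundary n) ⟩
  P 0 + sumℕ n B + B n          ≡⟨ +-assoc (P 0) (sumℕ n B) (B n) ⟩
  P 0 + (sumℕ n B + B n)        ∎
  where
  open ≡-Reasoning

-- A potential for part (2)

𝟙 : Bool → ℕ
𝟙 true  = 1
𝟙 false = 0

δ₀ δ₁ : ℕ → ℕ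
δ₀ zero    = 1
δ₀ (suc _) = 0
δ₁ zero    = 0
δ₁ (suc n) = δ₀ n

sideHeight-indicator : ∀ {a L} → L ≤ a → 𝟙 (0 <ᵇ sideHeight a L) + δ₁ L + δ₀ a ≡ 1
sideHeight-indicator {zero}  {zero}        _ = refl
sideHeight-indicator {suc a} {zero}        _ = refl
sideHeight-indicator {suc a} {suc zero}    _ = refl
sideHeight-indicator {suc a} {suc (suc l)} _ = refl

-- 𝟙 (m <ᵇ a) is χ_{c_k}, the element c_k having index m = k - 1.
defect : ℕ → State → ℕ
defect m (a , L , R) = 2 * δ₀ a + δ₁ L + δ₁ R + 𝟙 (m <ᵇ a)

-- The last summand lives on the states with L ≡ R, which rowmotion preserves and on which
-- a wrap resets both side clocks at once.
potential : ℕ → State → ℕ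
potential k (a , L , R) =
  2 * (a + L + R) + (k + 2) * (2 * δ₀ a + (δ₀ L + δ₁ L) + (δ₀ R + δ₁ R)) + 𝟙 (L ≡ᵇ R) * (a ∸ L)

module _ {m : ℕ} where

  private
    k : ℕ
    k = suc m

  Coboundary : State → Set
  Coboundary t = potential k (step k t) + (k + 2) * defect m t ≡ potential k t + 6

  potential-tick : ∀ {a L R} → a < k → Coboundary (a , L , R)
  potential-tick {a} {L} {R} a<k rewrite step-< {L = L} {R} a<k | <ᵇ-false (≤⇒≯ (s≤s⁻¹ a<k)) =
    identity m a L R (δ₀ a) (δ₀ L) (δ₁ L) (δ₀ R) (δ₁ R) (𝟙 (L ≡ᵇ R) * (a ∸ L))
    where
    identity : ∀ m a L R a₀ l₀ l₁ r₀ r₁ κ →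
      2 * (suc a + suc L + suc R) + (suc m + 2) * (l₀ + r₀) + κ
        + (suc m + 2) * (2 * a₀ + l₁ + r₁ + 0)
      ≡ 2 * (a + L + R) + (suc m + 2) * (2 * a₀ + (l₀ + l₁) + (r₀ + r₁)) + κ + 6
    identity = solve-∀

  potential-wrap-> : ∀ {L R} → R < L → Coboundary (k , L , R)
  potential-wrap-> {L} {R} R<L with m≤n⇒∃[o]m+o≡n R<L
  ... | p , refl rewrite step-≡ {k} {k} {suc (R + p)} {R} refl | wrap-> R<L | <ᵇ-true (n<1+n m)
                       | ≡ᵇ-false (λ L≡R → <-irrefl (sym L≡R) R<L) =
    identity m (R + p) R (δ₀ (R + p)) (δ₀ R) (δ₁ R)
    where
    identity : ∀ m l R l₀ r₀ r₁ →
      2 * (suc l + 0 + suc R) + (suc m + 2) * suc r₀ + 0 + (suc m + 2) * (l₀ + r₁ + 1)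
      ≡ 2 * (suc m + suc l + R) + (suc m + 2) * (l₀ + (r₀ + r₁)) + 0 + 6
    identity = solve-∀

  potential-wrap-< : ∀ {L R} → L < R → Coboundary (k , L , R)
  potential-wrap-< {L} {R} L<R with m≤n⇒∃[o]m+o≡n L<R
  ... | p , refl rewrite step-≡ {k} {k} {L} {suc (L + p)} refl | wrap-< L<R | <ᵇ-true (n<1+n m)
                       | ≡ᵇ-false (λ L≡R → <-irrefl L≡R L<R) =
    identity m L (L + p) (δ₀ L) (δ₁ L) (δ₀ (L + p))
    where
    identity : ∀ m L r l₀ l₁ r₀ →
      2 * (suc r + suc L + 0) + (suc m + 2) * (l₀ + 1) + 0 + (suc m + 2) * (l₁ + r₀ + 1)
      ≡ 2 * (suc m + L + suc r) + (suc m + 2) * (l₀ + l₁ + r₀) + 0 + 6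
    identity = solve-∀

  potential-wrap-≡ : ∀ {L} → L ≤ k → Coboundary (k , L , L)
  potential-wrap-≡ {L} L≤k with m≤n⇒∃[o]m+o≡n L≤k
  ... | q , L+q≡k rewrite step-≡ {k} {k} {L} {L} refl | wrap-≡ L | <ᵇ-true (n<1+n m) | ≡ᵇ-refl L =
    identity k L q (δ₀ L) (δ₁ L) L+q≡k
    where
    polynomial : ∀ L q l₀ l₁ →
      2 * (L + 0 + 0) + (L + q + 2) * (2 * l₀ + 1 + 1) + (L + 0) + (L + q + 2) * (l₁ + l₁ + 1)
      ≡ 2 * (L + q + L + L) + (L + q + 2) * (l₀ + l₁ + (l₀ + l₁)) + (q + 0) + 6
    polynomial = solve-∀
    identity : ∀ K L q l₀ l₁ → L + q ≡ K →
      2 * (L + 0 + 0) + (K + 2) * (2 * l₀ + 1 + 1) + (L + 0) + (K + 2) * (l₁ + l₁ + 1)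
      ≡ 2 * (K + L + L) + (K + 2) * (l₀ + l₁ + (l₀ + l₁)) + ((K ∸ L) + 0) + 6
    identity _ L q l₀ l₁ refl rewrite m+n∸m≡n L q = polynomial L q l₀ l₁

  potential-step : ∀ {t} → Valid k t → Coboundary t
  potential-step {a , L , R} (L≤a , R≤a , a≤k) with m≤n⇒m<n∨m≡n a≤k
  ... | inj₁ a<k = potential-tick a<k
  ... | inj₂ refl with <-cmp L R
  ...   | tri< L<R _ _ = potential-wrap-< L<R
  ...   | tri≈ _ refl _ = potential-wrap-≡ L≤a
  ...   | tri> _ _ R<L = potential-wrap-> R<L

  statistic+defect : ∀ {t} → Valid k t →
    𝟙 (0 <ᵇ heights t ℓ) + 𝟙 (0 <ᵇ heights t r) + defect m t ≡ 2 + 𝟙 (m <ᵇ heights t c)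
  statistic+defect {a , L , R} (L≤a , R≤a , _) = begin
    x + y + (2 * δ₀ a + δ₁ L + δ₁ R + z)
      ≡⟨ regroup x y (δ₀ a) (δ₁ L) (δ₁ R) z ⟩
    (x + δ₁ L + δ₀ a) + (y + δ₁ R + δ₀ a) + z
      ≡⟨ cong₂ (λ u v → u + v + z) (sideHeight-indicator L≤a) (sideHeight-indicator R≤a) ⟩
    2 + z ∎
    where
    open ≡-Reasoning
    x y z : ℕ
    x = 𝟙 (0 <ᵇ sideHeight a L)
    y = 𝟙 (0 <ᵇ sideHeight a R)
    z = 𝟙 (m <ᵇ a)
    regroup : ∀ x y a₀ l₁ r₁ z → x + y + (2 * a₀ + l₁ + r₁ + z) ≡ (x + l₁ + a₀) + (y + r₁ + a₀) + z
    regroup = solve-∀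

  potential-statistic : ∀ {t} → Valid k t →
    potential k (step k t) + (2 * m + (k + 2) * 𝟙 (m <ᵇ heights t c))
      ≡ potential k t + (k + 2) * (𝟙 (0 <ᵇ heights t ℓ) + 𝟙 (0 <ᵇ heights t r))
  potential-statistic {t} valid = +-cancelʳ-≡ (K * D) _ _ (begin
    P′ + (2 * m + K * Z) + K * D  ≡⟨ xy∙z≈xz∙y P′ (2 * m + K * Z) (K * D) ⟩
    P′ + K * D + (2 * m + K * Z)  ≡⟨ cong (_+ (2 * m + K * Z)) (potential-step valid) ⟩
    P + 6 + (2 * m + K * Z)       ≡⟨ six-plus m P Z ⟩
    P + K * (2 + Z)               ≡⟨ cong (λ u → P + K * u) (sym (statistic+defect valid)) ⟩
    P + K * (X + D)               ≡⟨ distribute P K X D ⟩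
    P + K * X + K * D             ∎)
    where
    open ≡-Reasoning
    K P P′ D X Z : ℕ
    K = k + 2
    P = potential k t
    P′ = potential k (step k t)
    D = defect m t
    X = 𝟙 (0 <ᵇ heights t ℓ) + 𝟙 (0 <ᵇ heights t r)
    Z = 𝟙 (m <ᵇ heights t c)
    six-plus : ∀ m P Z → P + 6 + (2 * m + (suc m + 2) * Z) ≡ P + (suc m + 2) * (2 + Z)
    six-plus = solve-∀
    distribute : ∀ P K X D → P + K * (X + D) ≡ P + K * X + K * D
    distribute = solve-∀

ι : ℕ → ℚ
ι n = + n / 1

toℚᵘ-ι : ∀ n → toℚᵘ (ι n) ℚᵘ.≃ mkℚᵘ (+ n) 0
toℚᵘ-ι n = toℚᵘ-fromℚᵘ (mkℚᵘ (+ n) 0)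

ι-+ : ∀ m n → ι (m + n) ≡ ι m ℚ.+ ι n
ι-+ m n = toℚᵘ-injective (begin
  toℚᵘ (ι (m + n))                   ≈⟨ toℚᵘ-ι (m + n) ⟩
  mkℚᵘ (+ (m + n)) 0                 ≈⟨ *≡* (cong (ℤ._* + 1) (trans (ℤ.pos-+ m n) (unit-denominators (+ m) (+ n)))) ⟩
  mkℚᵘ (+ m) 0 ℚᵘ.+ mkℚᵘ (+ n) 0     ≈⟨ ℚᵘ.+-cong (ℚᵘ.≃-sym (toℚᵘ-ι m)) (ℚᵘ.≃-sym (toℚᵘ-ι n)) ⟩
  toℚᵘ (ι m) ℚᵘ.+ toℚᵘ (ι n)         ≈⟨ ℚᵘ.≃-sym (toℚᵘ-homo-+ (ι m) (ι n)) ⟩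
  toℚᵘ (ι m ℚ.+ ι n)                 ∎)
  where
  open ℚᵘ.≃-Reasoning
  unit-denominators : ∀ x y → x ℤ.+ y ≡ x ℤ.* + 1 ℤ.+ y ℤ.* + 1
  unit-denominators = ℤ-Solver.solve-∀

ι-sub≡fraction : ∀ {X Z n p d} → suc d * X ≡ n * p + suc d * Z → ι X ℚ.- ι Z ≡ ι n ℚ.* (+ p / suc d)
ι-sub≡fraction {X} {Z} {n} {p} {d} eq = toℚᵘ-injective (begin
  toℚᵘ (ι X ℚ.- ι Z)
    ≈⟨ ℚᵘ.≃-trans (toℚᵘ-homo-+ (ι X) (ℚ.- ι Z)) (ℚᵘ.+-congʳ (toℚᵘ (ι X)) (toℚᵘ-homo‿- (ι Z))) ⟩
  toℚᵘ (ι X) ℚᵘ.- toℚᵘ (ι Z)         ≈⟨ ℚᵘ.+-cong (toℚᵘ-ι X) (ℚᵘ.-‿cong (toℚᵘ-ι Z)) ⟩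
  mkℚᵘ (+ X) 0 ℚᵘ.- mkℚᵘ (+ Z) 0     ≈⟨ *≡* cross-multiplied ⟩
  mkℚᵘ (+ n) 0 ℚᵘ.* mkℚᵘ (+ p) d     ≈⟨ ℚᵘ.*-cong (ℚᵘ.≃-sym (toℚᵘ-ι n)) (ℚᵘ.≃-sym (toℚᵘ-fromℚᵘ (mkℚᵘ (+ p) d))) ⟩
  toℚᵘ (ι n) ℚᵘ.* toℚᵘ (+ p / suc d) ≈⟨ ℚᵘ.≃-sym (toℚᵘ-homo-* (ι n) (+ p / suc d)) ⟩
  toℚᵘ (ι n ℚ.* (+ p / suc d))       ∎)
  where
  open ℚᵘ.≃-Reasoning
  D N : ℤ
  D = + suc d
  N = + n ℤ.* + p
  eqℤ : D ℤ.* + X ≡ N ℤ.+ D ℤ.* + Z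
  eqℤ = trans (sym (ℤ.pos-* (suc d) X)) (trans (cong +_ eq)
          (trans (ℤ.pos-+ (n * p) (suc d * Z)) (cong₂ ℤ._+_ (ℤ.pos-* n p) (ℤ.pos-* (suc d) Z))))
  expand : ∀ X Z D → (X ℤ.* + 1 ℤ.+ ℤ.- Z ℤ.* + 1) ℤ.* (+ 1 ℤ.* D) ≡ D ℤ.* X ℤ.- D ℤ.* Z
  expand = ℤ-Solver.solve-∀
  cancel : ∀ N Y → N ℤ.+ Y ℤ.- Y ≡ N ℤ.* (+ 1 ℤ.* + 1)
  cancel = ℤ-Solver.solve-∀
  -- X/1 - Z/1 ≃ N/D cross-multiplied, in the shape in which ℚᵘ's _-_, _*_ and _≃_ unfold
  cross-multiplied : (+ X ℤ.* + 1 ℤ.+ ℤ.- + Z ℤ.* + 1) ℤ.* (+ 1 ℤ.* D) ≡ N ℤ.* (+ 1 ℤ.* + 1)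
  cross-multiplied = trans (expand (+ X) (+ Z) D) (trans (cong (ℤ._- D ℤ.* + Z) eqℤ) (cancel N (D ℤ.* + Z)))

sumTo-cong : ∀ n {f g : ℕ → ℚ} → (∀ j → f j ≡ g j) → sumTo n f ≡ sumTo n g
sumTo-cong zero    f≗g = refl
sumTo-cong (suc n) f≗g = cong₂ ℚ._+_ (sumTo-cong n f≗g) (f≗g n)

sumTo-ι-sub : ∀ n (f g : ℕ → ℕ) → sumTo n (λ j → ι (f j) ℚ.- ι (g j)) ≡ ι (sumℕ n f) ℚ.- ι (sumℕ n g)
sumTo-ι-sub zero    f g = refl
sumTo-ι-sub (suc n) f g = begin
  sumTo n (λ j → ι (f j) ℚ.- ι (g j)) ℚ.+ (ι (f n) ℚ.- ι (g n))
    ≡⟨ cong (ℚ._+ (ι (f n) ℚ.- ι (g n))) (sumTo-ι-sub n f g) ⟩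
  (ι F ℚ.- ι G) ℚ.+ (ι (f n) ℚ.- ι (g n))
    ≡⟨ regroup (ι F) (ι G) (ι (f n)) (ι (g n)) ⟩
  (ι F ℚ.+ ι (f n)) ℚ.- (ι G ℚ.+ ι (g n))
    ≡⟨ sym (cong₂ ℚ._-_ (ι-+ F (f n)) (ι-+ G (g n))) ⟩
  ι (F + f n) ℚ.- ι (G + g n) ∎
  where
  open ≡-Reasoning
  F G : ℕ
  F = sumℕ n f
  G = sumℕ n g
  regroup : ∀ a b x y → (a ℚ.- b) ℚ.+ (x ℚ.- y) ≡ (a ℚ.+ x) ℚ.- (b ℚ.+ y)
  regroup = +-*-Solver.solve 4 (λ a b x y → (a :- b) :+ (x :- y) := (a :+ x) :- (b :+ y)) refl
    where open +-*-Solver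

χ≡ι𝟙 : ∀ {k} (s : Elem k) I → χ s I ≡ ι (𝟙 (mem I s))
χ≡ι𝟙 s I with mem I s
... | true  = refl
... | false = refl

χ-idealOf : ∀ {k} v (i : Fin k) t → χ (v , i) (idealOf t) ≡ ι (𝟙 (toℕ i <ᵇ heights t v))
χ-idealOf v i t = trans (χ≡ι𝟙 (v , i) (idealOf t)) (cong (ι ∘ 𝟙) (mem-fromPred (belowHeights (heights t)) (v , i)))

telescope-closed : ∀ (P A B : ℕ → ℕ) → (∀ j → P (suc j) + A j ≡ P j + B j) →
  ∀ n → P n ≡ P 0 → sumℕ n A ≡ sumℕ n B
telescope-closed P A B coboundary n closes =
  +-cancelˡ-≡ (P 0) _ _ (trans (cong (_+ sumℕ n A) (sym closes)) (telescope P A B coboundary n))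

valid-iter : ∀ {k t} → Valid k t → ∀ j → Valid k (iter (step k) j t)
valid-iter {k} valid j = iter-preserves {P = Valid k} (step k) valid-step j valid

module _ {k t n} (valid : Valid k t) (closes : iter (step k) n t ≡ t) where

  sides-balanced : ∀ i → sumℕ n (λ j → 𝟙 (i <ᵇ heights (iter (step k) j t) ℓ))
                       ≡ sumℕ n (λ j → 𝟙 (i <ᵇ heights (iter (step k) j t) r))
  sides-balanced i = begin
    sumℕ n (count ℓ)
      ≡⟨ sym (sumℕ-periodic n (count ℓ) (cong (level ℓ) ∘ iter-periodic (step k) {n} closes) (2 + k)) ⟩
    sumℕ n (λ j → count ℓ (2 + k + j))
      ≡⟨ sumℕ-cong n (λ j → cong (level ℓ) (trans (iter-+ (step k) (2 + k) j t) (period (valid-iter valid j)))) ⟩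
    sumℕ n (count r)
      ∎
    where
    open ≡-Reasoning
    level : V → State → ℕ
    level v s = 𝟙 (i <ᵇ heights s v)
    count : V → ℕ → ℕ
    count v j = level v (iter (step k) j t)

module _ {m t n} (valid : Valid (suc m) t) (closes : iter (step (suc m)) n t ≡ t) where

  private
    k : ℕ
    k = suc m
    orbit : ℕ → State
    orbit j = iter (step k) j t

  corner-balance :
    (k + 2) * sumℕ n (λ j → 𝟙 (0 <ᵇ heights (orbit j) ℓ) + 𝟙 (0 <ᵇ heights (orbit j) r))
      ≡ n * (2 * m) + (k + 2) * sumℕ n (λ j → 𝟙 (m <ᵇ heights (orbit j) c))
  corner-balance = begin
    (k + 2) * sumℕ n X                                   ≡⟨ sym (sumℕ-*ˡ n (k + 2) X) ⟩
    sumℕ n (λ j → (k + 2) * X j)                         ≡⟨ sym (telescope-closed P _ _ coboundary n (cong (potential k) closes)) ⟩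
    sumℕ n (λ j → 2 * m + (k + 2) * Z j)                 ≡⟨ sumℕ-+ n (λ _ → 2 * m) (λ j → (k + 2) * Z j) ⟩
    sumℕ n (λ _ → 2 * m) + sumℕ n (λ j → (k + 2) * Z j)  ≡⟨ cong₂ _+_ (sumℕ-const n (2 * m)) (sumℕ-*ˡ n (k + 2) Z) ⟩
    n * (2 * m) + (k + 2) * sumℕ n Z                     ∎
    where
    open ≡-Reasoning
    X Z P : ℕ → ℕ
    X j = 𝟙 (0 <ᵇ heights (orbit j) ℓ) + 𝟙 (0 <ᵇ heights (orbit j) r)
    Z j = 𝟙 (m <ᵇ heights (orbit j) c)
    P j = potential k (orbit j)
    coboundary : ∀ j → P (suc j) + (2 * m + (k + 2) * Z j) ≡ P j + (k + 2) * X j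
    coboundary j = potential-statistic (valid-iter valid j)

module _ {k} {x : Sub k} (ideal : IsOrderIdeal x) where

  orbit-idealOf : ∀ j → iter rowmotion j x ≡ idealOf (iter (step k) j (stateOf x))
  orbit-idealOf j = begin
    iter rowmotion j x                      ≡⟨ cong (iter rowmotion j) (sym (idealOf-stateOf ideal)) ⟩
    iter rowmotion j (idealOf (stateOf x))
      ≡⟨ iter-intertwine (step k) rowmotion idealOf valid-step rowmotion-idealOf j (valid-stateOf ideal) ⟩
    idealOf (iter (step k) j (stateOf x))   ∎
    where open ≡-Reasoning

  orbit-closes : ∀ {n} → iter rowmotion n x ≡ x → iter (step k) n (stateOf x) ≡ stateOf x
  orbit-closes {n} closes = begin
    iter (step k) n (stateOf x)                      ≡⟨ sym (stateOf-idealOf (valid-iter (valid-stateOf ideal) n)) ⟩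
    stateOf (idealOf (iter (step k) n (stateOf x)))  ≡⟨ cong stateOf (sym (orbit-idealOf n)) ⟩
    stateOf (iter rowmotion n x)                     ≡⟨ cong stateOf closes ⟩
    stateOf x                                        ∎
    where open ≡-Reasoning

  χ-orbit : ∀ v i j → χ (v , i) (iter rowmotion j x) ≡ ι (𝟙 (toℕ i <ᵇ heights (iter (step k) j (stateOf x)) v))
  χ-orbit v i j = trans (cong (χ (v , i)) (orbit-idealOf j)) (χ-idealOf v i (iter (step k) j (stateOf x)))

χℓᵢ-χrᵢ-mesic : ∀ m (i : Fin (suc m)) →
  Mesic (IsOrderIdeal {suc m}) rowmotion (λ I → χ (ℓ , i) I ℚ.- χ (r , i) I) 0ℚ
χℓᵢ-χrᵢ-mesic m i x ideal n (_ , closes , _) = begin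
  sumTo n (λ j → χ (ℓ , i) (ρ j) ℚ.- χ (r , i) (ρ j))
    ≡⟨ sumTo-cong n (λ j → cong₂ ℚ._-_ (χ-orbit ideal ℓ i j) (χ-orbit ideal r i j)) ⟩
  sumTo n (λ j → ι (count ℓ j) ℚ.- ι (count r j))      ≡⟨ sumTo-ι-sub n (count ℓ) (count r) ⟩
  ι (sumℕ n (count ℓ)) ℚ.- ι (sumℕ n (count r))        ≡⟨ cong (λ s → ι s ℚ.- ι (sumℕ n (count r))) balanced ⟩
  ι (sumℕ n (count r)) ℚ.- ι (sumℕ n (count r))        ≡⟨ ℚ.+-inverseʳ (ι (sumℕ n (count r))) ⟩
  0ℚ                                                   ≡⟨ sym (ℚ.*-zeroʳ (ι n)) ⟩
  ι n ℚ.* 0ℚ                                           ∎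
  where
  open ≡-Reasoning
  ρ : ℕ → Sub (suc m)
  ρ j = iter rowmotion j x
  count : V → ℕ → ℕ
  count v j = 𝟙 (toℕ i <ᵇ heights (iter (step (suc m)) j (stateOf x)) v)
  balanced : sumℕ n (count ℓ) ≡ sumℕ n (count r)
  balanced = sides-balanced {n = n} (valid-stateOf ideal) (orbit-closes ideal {n} closes) (toℕ i)

χℓ₁+χr₁-χcₖ-mesic : ∀ m →
  Mesic (IsOrderIdeal {suc m}) rowmotion
    (λ I → (χ (ℓ , zero) I ℚ.+ χ (r , zero) I) ℚ.- χ (c , fromℕ m) I)
    ((+ (2 * (suc m ∸ 1))) / (suc m + 2))
χℓ₁+χr₁-χcₖ-mesic m x ideal n (_ , closes , _) = begin
  sumTo n (λ j → g (ρ j))              ≡⟨ sumTo-cong n pointwise ⟩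
  sumTo n (λ j → ι (X j) ℚ.- ι (Z j))  ≡⟨ sumTo-ι-sub n X Z ⟩
  ι (sumℕ n X) ℚ.- ι (sumℕ n Z)        ≡⟨ ι-sub≡fraction {sumℕ n X} {sumℕ n Z} {n} {2 * m} {m + 2} balance ⟩
  ι n ℚ.* (+ (2 * m) / (suc m + 2))    ∎
  where
  open ≡-Reasoning
  g : Sub (suc m) → ℚ
  g I = (χ (ℓ , zero) I ℚ.+ χ (r , zero) I) ℚ.- χ (c , fromℕ m) I
  ρ : ℕ → Sub (suc m)
  ρ j = iter rowmotion j x
  level : V → ℕ → ℕ → ℕ
  level v i j = 𝟙 (i <ᵇ heights (iter (step (suc m)) j (stateOf x)) v)
  X Z : ℕ → ℕ
  X j = level ℓ 0 j + level r 0 j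
  Z j = level c m j
  pointwise : ∀ j → g (ρ j) ≡ ι (X j) ℚ.- ι (Z j)
  pointwise j = cong₂ ℚ._-_
    (trans (cong₂ ℚ._+_ (χ-orbit ideal ℓ zero j) (χ-orbit ideal r zero j)) (sym (ι-+ (level ℓ 0 j) (level r 0 j))))
    (trans (χ-orbit ideal c (fromℕ m) j) (cong (λ u → ι (level c u j)) (toℕ-fromℕ m)))
  balance : (suc m + 2) * sumℕ n X ≡ n * (2 * m) + (suc m + 2) * sumℕ n Z
  balance = corner-balance {n = n} (valid-stateOf ideal) (orbit-closes ideal {n} closes)

theorem3p3 : (m : ℕ) →
    let k = suc m in
    ((i : Fin k) →
      Mesic (IsOrderIdeal {k}) rowmotion (λ I → χ (ℓ , i) I ℚ.- χ (r , i) I) 0ℚ)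
    ×
    Mesic (IsOrderIdeal {k}) rowmotion
      (λ I → (χ (ℓ , zero) I ℚ.+ χ (r , zero) I) ℚ.- χ (c , fromℕ m) I)
      ((+ (2 * (k ∸ 1))) / (k + 2))
theorem3p3 m = χℓᵢ-χrᵢ-mesic m , χℓ₁+χr₁-χcₖ-mesic m
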